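{- There is an absolute constant $C$ such that for every graph $G$ on $n$ vertices with $c_b(G)=1$, we have $\mathrm{capt}_b(G)\le C n^3$; that is, $\mathrm{capt}_b(G)=O(n^3)$.
   Context: Bridge-burning Cops and Robbers is played on a finite graph $G$ by a team of cops and a single robber, with full information. First each cop chooses a starting vertex (several cops may share a vertex), then the robber chooses a starting vertex. The game then proceeds in rounds; in each round, first every cop either stays put or moves along an edge of the current graph to an adjacent vertex, and then the robber either stays put or moves along an edge of the current graph. Every edge traversed by the robber is immediately deleted from the graph (cop moves delete nothing). The cops win if at some moment some cop occupies the same vertex as the robber; the robber wins if he avoids this forever. $c_b(G)$ is the minimum number of cops for which the cops have a winning strategy. The bridge-burning capture time $\mathrm{capt}_b(G)$ is the minimum number of rounds within which $c_b(G)$ cops can guarantee capturing the robber. -}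

module Defs where

open import Data.Nat using (ℕ; zero; suc)
open import Data.Fin using (Fin; _≟_)
open import Data.Bool using (Bool; true; false; if_then_else_; _∧_; _∨_)
open import Data.Product using (Σ; _×_; _,_)
open import Data.Sum using (_⊎_)
open import Relation.Binary.PropositionalEquality using (_≡_)
open import Relation.Nullary.Decidable using (⌊_⌋)

record Graph (n : ℕ) : Set where
  field
    adj    : Fin n → Fin n → Bool
    sym    : ∀ x y → adj x y ≡ adj y x
    irrefl : ∀ x → adj x x ≡ false
open Graph public

Edges : ℕ → Set
Edges n = Fin n → Fin n → Bool

Move : ∀ {n} → Edges n → Fin n → Fin n → Set
Move E x y = (y ≡ x) ⊎ (E x y ≡ true)

-- Delete the (unordered) edge {a,b}; if a = b nothing is traversed
-- (the edge {a,a} does not exist in a simple graph anyway).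
burn : ∀ {n} → Edges n → Fin n → Fin n → Edges n
burn E a b x y =
  if (⌊ x ≟ a ⌋ ∧ ⌊ y ≟ b ⌋) ∨ (⌊ x ≟ b ⌋ ∧ ⌊ y ≟ a ⌋) then false else E x y

-- Position with the cop to move: current edges E, cop at c, robber at r.
-- CopWin E c r : the single cop has a strategy guaranteeing capture
-- (inductive = well-founded game tree, i.e. capture at some finite time
-- against every robber play).
data CopWin {n : ℕ} (E : Edges n) (c r : Fin n) : Set where
  caught : c ≡ r → CopWin E c r
  step   : (c' : Fin n) → Move E c c' →
           ((c' ≡ r) ⊎
            ((r' : Fin n) → Move E r r' → CopWin (burn E r r') c' r')) →
           CopWin E c r

CopWinIn : {n : ℕ} → ℕ → Edges n → Fin n → Fin n → Set
CopWinIn zero    E c r = c ≡ r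
CopWinIn (suc k) E c r =
  (c ≡ r) ⊎
  Σ (Fin _) λ c' → Move E c c' ×
    ((c' ≡ r) ⊎ ((r' : Fin _) → Move E r r' → CopWinIn k (burn E r r') c' r'))

-- c_b(G) = 1 (for a graph with at least one vertex, 0 cops never win):
-- one cop chooses a start, then for every robber start the cop wins.
OneCopWins : ∀ {n} → Graph n → Set
OneCopWins {n} G = Σ (Fin n) λ c₀ → (r₀ : Fin n) → CopWin (adj G) c₀ r₀

CaptureWithin : ∀ {n} → Graph n → ℕ → Set
CaptureWithin {n} G k = Σ (Fin n) λ c₀ → (r₀ : Fin n) → CopWinIn k (adj G) c₀ r₀

module Submission where

-- Edge deletions are irreversible, so a play splits into phases between
-- consecutive edge traversals of the robber.  During a phase the robber sits
-- at a fixed vertex r and the edge set E is fixed; only the cop moves.  Let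
-- B bound the capture time of every won position reached by one traversal,
-- and let W j be the set of cop positions winning within j + B rounds.  The
-- sets W j increase with j, and once W (j + 1) = W j they stay equal; such a
-- chain of subsets of an n-element set is constant from index n on (counting
-- argument).  Hence every won position is won within n + B rounds (phase
-- lemma).  Each traversal deletes an edge and there are at most n² ordered
-- adjacent pairs, so induction on their number bounds the capture time by
-- (n² + 1)·n ≤ 2n³.

open import Defs
open import Data.Nat using (ℕ; _*_; _^_)
open import Data.Product using (Σ)

open import Data.Nat using (zero; suc; _+_; _≤_; _<_; z≤n; s≤s)
open import Data.Nat.Properties
  using (+-mono-≤; +-mono-<-≤; +-mono-≤-<; +-monoˡ-≤; <-≤-trans; ≤-pred;
         <-irrefl; n≮0; n≤1+n; m≤n+m; m≤m*n; module ≤-Reasoning)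
open import Data.Nat.Tactic.RingSolver using (solve-∀)
open import Data.Fin using (Fin; _≟_) renaming (zero to fzero; suc to fsuc)
open import Data.Fin.Properties using (any?; all?; ¬∀⟶∃¬)
open import Data.Fin.Subset using (Subset; _∈_; _⊆_; _⊂_; ∣_∣)
open import Data.Fin.Subset.Properties
  using (_∈?_; _⊆?_; ∣p∣≤n; p⊆q⇒∣p∣≤∣q∣; p⊂q⇒∣p∣<∣q∣)
open import Data.Vec using (tabulate)
open import Data.Vec.Properties using (lookup∘tabulate; lookup⇒[]=; []=⇒lookup)
open import Data.Bool using (Bool; true; false; if_then_else_; _∧_; _∨_)
open import Data.Bool.Properties using () renaming (_≟_ to _≟ᵇ_)
open import Data.Product using (_×_; _,_)
open import Data.Sum using (_⊎_; inj₁; inj₂)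
open import Data.Empty using (⊥-elim)
open import Relation.Nullary using (¬_; Dec; yes; no; does; contradiction)
open import Relation.Nullary.Decidable using (⌊_⌋; dec-true; _⊎-dec_; _×-dec_; _→-dec_)
open import Relation.Binary.PropositionalEquality
  using (_≡_; refl; trans; cong) renaming (sym to ≡-sym)

∑ : ∀ {n} → (Fin n → ℕ) → ℕ
∑ {zero}  f = 0
∑ {suc n} f = f fzero + ∑ (λ i → f (fsuc i))

∑-mono : ∀ {n} {f g : Fin n → ℕ} → (∀ i → f i ≤ g i) → ∑ f ≤ ∑ g
∑-mono {zero}  f≤g = z≤n
∑-mono {suc n} f≤g = +-mono-≤ (f≤g fzero) (∑-mono (λ i → f≤g (fsuc i)))

∑-mono-< : ∀ {n} {f g : Fin n → ℕ} → (∀ i → f i ≤ g i) →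
           ∀ i → f i < g i → ∑ f < ∑ g
∑-mono-< {suc n} f≤g fzero    fi<gi = +-mono-<-≤ fi<gi (∑-mono (λ i → f≤g (fsuc i)))
∑-mono-< {suc n} f≤g (fsuc i) fi<gi =
  +-mono-≤-< (f≤g fzero) (∑-mono-< (λ j → f≤g (fsuc j)) i fi<gi)

∑-≤ : ∀ {n b} {f : Fin n → ℕ} → (∀ i → f i ≤ b) → ∑ f ≤ n * b
∑-≤ {zero}  f≤b = z≤n
∑-≤ {suc n} f≤b = +-mono-≤ (f≤b fzero) (∑-≤ (λ i → f≤b (fsuc i)))

∈-tabulate⁺ : ∀ {n} {f : Fin n → Bool} {x} → f x ≡ true → x ∈ tabulate f
∈-tabulate⁺ {f = f} {x} fx = lookup⇒[]= x (tabulate f) (trans (lookup∘tabulate f x) fx)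

∈-tabulate⁻ : ∀ {n} {f : Fin n → Bool} {x} → x ∈ tabulate f → f x ≡ true
∈-tabulate⁻ {f = f} {x} x∈f = trans (≡-sym (lookup∘tabulate f x)) ([]=⇒lookup x∈f)

⊆∧⊉⇒⊂ : ∀ {n} {p q : Subset n} → p ⊆ q → ¬ (q ⊆ p) → p ⊂ q
⊆∧⊉⇒⊂ {n} {p} {q} p⊆q q⊈p
  with ¬∀⟶∃¬ n (λ x → x ∈ q → x ∈ p) (λ x → x ∈? q →-dec x ∈? p)
              (λ q⊆p → q⊈p (q⊆p _))
... | x , ¬[x∈q⇒x∈p] with x ∈? q
...   | yes x∈q = p⊆q , x , x∈q , λ x∈p → ¬[x∈q⇒x∈p] (λ _ → x∈p)
...   | no  x∉q = ⊥-elim (¬[x∈q⇒x∈p] (λ x∈q → contradiction x∈q x∉q))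

-- An increasing chain of subsets of an n-element set in which one step of
-- stagnation forces the next has stagnated by step n: until it stagnates it
-- gains an element at every step.
subset-chain-stagnates :
  ∀ {n} (K : ℕ → Subset n) → (∀ j → K j ⊆ K (suc j)) →
  (∀ j → K (suc j) ⊆ K j → K (suc (suc j)) ⊆ K (suc j)) →
  K (suc n) ⊆ K n
subset-chain-stagnates {n} K increasing propagates with K (suc n) ⊆? K n
... | yes stagnant = stagnant
... | no  growing  =
  contradiction (<-≤-trans (large n growing) (∣p∣≤n (K (suc n)))) (<-irrefl refl)
  where
  grows : ∀ j → ¬ (K (suc j) ⊆ K j) → ∣ K j ∣ < ∣ K (suc j) ∣
  grows j K₁⊈K₀ = p⊂q⇒∣p∣<∣q∣ (⊆∧⊉⇒⊂ (increasing j) K₁⊈K₀)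

  large : ∀ j → ¬ (K (suc j) ⊆ K j) → j < ∣ K (suc j) ∣
  large zero    growing₀ = <-≤-trans (s≤s z≤n) (grows 0 growing₀)
  large (suc j) growing₁ = <-≤-trans (s≤s (large j growing₀)) (grows (suc j) growing₁)
    where
    growing₀ : ¬ (K (suc j) ⊆ K j)
    growing₀ stagnant = growing₁ (propagates j stagnant)

predicate-chain-stagnates :
  ∀ {n} (P : ℕ → Fin n → Set) → (∀ j x → Dec (P j x)) →
  (∀ j {x} → P j x → P (suc j) x) →
  (∀ j → (∀ {x} → P (suc j) x → P j x) → ∀ {x} → P (suc (suc j)) x → P (suc j) x) →
  ∀ {x} → P (suc n) x → P n x
predicate-chain-stagnates {n} P P? increasing propagates p =
  from (subset-chain-stagnates K (λ j x∈K → to (increasing j (from x∈K)))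
          (λ j stagnant x∈K → to (propagates j (λ q → from (stagnant (to q))) (from x∈K)))
          (to p))
  where
  K : ℕ → Subset n
  K j = tabulate (λ x → does (P? j x))

  to : ∀ {j x} → P j x → x ∈ K j
  to {j} {x} p = ∈-tabulate⁺ (dec-true (P? j x) p)

  from : ∀ {j x} → x ∈ K j → P j x
  from {j} {x} x∈K with P? j x | ∈-tabulate⁻ x∈K
  ... | yes p | _  = p
  ... | no  _ | ()

neighbours : ∀ {n} → Edges n → Fin n → Subset n
neighbours E x = tabulate (E x)

edgeCount : ∀ {n} → Edges n → ℕ
edgeCount E = ∑ (λ x → ∣ neighbours E x ∣)

edgeCount≤ : ∀ {n} (E : Edges n) → edgeCount E ≤ n * n
edgeCount≤ E = ∑-≤ (λ x → ∣p∣≤n (neighbours E x))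

≟-refl : ∀ {n} (a : Fin n) → ⌊ a ≟ a ⌋ ≡ true
≟-refl a with a ≟ a
... | yes _    = refl
... | no  a≢a = contradiction refl a≢a

burn-⊆ : ∀ {n} (E : Edges n) a b x y → burn E a b x y ≡ true → E x y ≡ true
burn-⊆ E a b x y with (⌊ x ≟ a ⌋ ∧ ⌊ y ≟ b ⌋) ∨ (⌊ x ≟ b ⌋ ∧ ⌊ y ≟ a ⌋)
... | true  = λ ()
... | false = λ Exy → Exy

burn-deletes : ∀ {n} (E : Edges n) a b → burn E a b a b ≡ false
burn-deletes E a b rewrite ≟-refl a | ≟-refl b = refl

edgeCount-burn : ∀ {n} (E : Edges n) a b → E a b ≡ true →
                 edgeCount (burn E a b) < edgeCount E
edgeCount-burn E a b Eab =
  ∑-mono-< (λ x → p⊆q⇒∣p∣≤∣q∣ (shrinks x)) a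
           (p⊂q⇒∣p∣<∣q∣ (shrinks a , b , ∈-tabulate⁺ Eab , gone))
  where
  shrinks : ∀ x → neighbours (burn E a b) x ⊆ neighbours E x
  shrinks x y∈ = ∈-tabulate⁺ (burn-⊆ E a b x _ (∈-tabulate⁻ y∈))

  gone : ¬ (b ∈ neighbours (burn E a b) a)
  gone b∈ with trans (≡-sym (burn-deletes E a b)) (∈-tabulate⁻ b∈)
  ... | ()

-- Edge relations with the same edges.  Staying put burns nothing, but
-- burn E r r is only pointwise equal to E, so the game is transported along
-- pointwise equality.
_≐_ : ∀ {n} → Edges n → Edges n → Set
E ≐ E' = ∀ x y → E x y ≡ E' x y

≐-refl : ∀ {n} {E : Edges n} → E ≐ E
≐-refl x y = refl

≐-sym : ∀ {n} {E E' : Edges n} → E ≐ E' → E' ≐ E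
≐-sym E≐E' x y = ≡-sym (E≐E' x y)

≐-trans : ∀ {n} {E E' E'' : Edges n} → E ≐ E' → E' ≐ E'' → E ≐ E''
≐-trans E≐E' E'≐E'' x y = trans (E≐E' x y) (E'≐E'' x y)

burn-resp : ∀ {n} {E E' : Edges n} {a b} → E ≐ E' → burn E a b ≐ burn E' a b
burn-resp {a = a} {b} E≐E' x y =
  cong (λ e → if (⌊ x ≟ a ⌋ ∧ ⌊ y ≟ b ⌋) ∨ (⌊ x ≟ b ⌋ ∧ ⌊ y ≟ a ⌋) then false else e)
       (E≐E' x y)

burn-stay : ∀ {n} (E : Edges n) a → E a a ≡ false → burn E a a ≐ E
burn-stay E a Eaa x y with x ≟ a | y ≟ a
... | yes refl | yes refl = ≡-sym Eaa
... | yes _    | no  _    = refl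
... | no  _    | _        = refl

move-resp : ∀ {n} {E E' : Edges n} {x y} → E ≐ E' → Move E x y → Move E' x y
move-resp E≐E' (inj₁ y≡x) = inj₁ y≡x
move-resp {x = x} {y} E≐E' (inj₂ Exy) = inj₂ (trans (≡-sym (E≐E' x y)) Exy)

copWinIn-resp : ∀ {n k} {E E' : Edges n} {c r} → E ≐ E' →
                CopWinIn k E c r → CopWinIn k E' c r
copWinIn-resp {k = zero}  E≐E' c≡r = c≡r
copWinIn-resp {k = suc k} E≐E' (inj₁ c≡r) = inj₁ c≡r
copWinIn-resp {k = suc k} E≐E' (inj₂ (c' , mv , inj₁ c'≡r)) =
  inj₂ (c' , move-resp E≐E' mv , inj₁ c'≡r)
copWinIn-resp {k = suc k} E≐E' (inj₂ (c' , mv , inj₂ win)) =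
  inj₂ (c' , move-resp E≐E' mv , inj₂ (λ r' mv' →
    copWinIn-resp (burn-resp E≐E') (win r' (move-resp (≐-sym E≐E') mv'))))

copWin-resp : ∀ {n} {E E' : Edges n} {c r} → E ≐ E' → CopWin E c r → CopWin E' c r
copWin-resp E≐E' (caught c≡r) = caught c≡r
copWin-resp E≐E' (step c' mv (inj₁ c'≡r)) = step c' (move-resp E≐E' mv) (inj₁ c'≡r)
copWin-resp E≐E' (step c' mv (inj₂ win)) =
  step c' (move-resp E≐E' mv) (inj₂ (λ r' mv' →
    copWin-resp (burn-resp E≐E') (win r' (move-resp (≐-sym E≐E') mv'))))

copWinIn⇒copWin : ∀ {n k} {E : Edges n} {c r} → CopWinIn k E c r → CopWin E c r
copWinIn⇒copWin {k = zero}  c≡r = caught c≡r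
copWinIn⇒copWin {k = suc k} (inj₁ c≡r) = caught c≡r
copWinIn⇒copWin {k = suc k} (inj₂ (c' , mv , inj₁ c'≡r)) = step c' mv (inj₁ c'≡r)
copWinIn⇒copWin {k = suc k} (inj₂ (c' , mv , inj₂ win)) =
  step c' mv (inj₂ (λ r' mv' → copWinIn⇒copWin (win r' mv')))

capturedIn : ∀ {n} k {E : Edges n} {c r} → c ≡ r → CopWinIn k E c r
capturedIn zero    c≡r = c≡r
capturedIn (suc k) c≡r = inj₁ c≡r

copWinIn-mono : ∀ {n k k'} {E : Edges n} {c r} → k ≤ k' →
                CopWinIn k E c r → CopWinIn k' E c r
copWinIn-mono {k' = k'} z≤n c≡r = capturedIn k' c≡r
copWinIn-mono (s≤s k≤k') (inj₁ c≡r) = inj₁ c≡r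
copWinIn-mono (s≤s k≤k') (inj₂ (c' , mv , inj₁ c'≡r)) = inj₂ (c' , mv , inj₁ c'≡r)
copWinIn-mono (s≤s k≤k') (inj₂ (c' , mv , inj₂ win)) =
  inj₂ (c' , mv , inj₂ (λ r' mv' → copWinIn-mono k≤k' (win r' mv')))

move? : ∀ {n} (E : Edges n) x y → Dec (Move E x y)
move? E x y = (y ≟ x) ⊎-dec (E x y ≟ᵇ true)

copWinIn? : ∀ {n} k (E : Edges n) c r → Dec (CopWinIn k E c r)
copWinIn? zero    E c r = c ≟ r
copWinIn? (suc k) E c r =
  (c ≟ r) ⊎-dec any? (λ c' → move? E c c' ×-dec ((c' ≟ r) ⊎-dec
    all? (λ r' → move? E r r' →-dec copWinIn? k (burn E r r') c' r')))

robberMove : ∀ {n} {E : Edges n} {r r'} → Move E r r' →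
             (E r r' ≡ true) ⊎ ((r' ≡ r) × (burn E r r ≐ E))
robberMove (inj₂ Err') = inj₁ Err'
robberMove {E = E} {r} (inj₁ refl) with E r r in Err
... | true  = inj₁ refl
... | false = inj₂ (refl , burn-stay E r Err)

module Phase {n} (E : Edges n) (r : Fin n) (B : ℕ)
  (afterTraversal : ∀ r' → E r r' ≡ true → ∀ c' →
                    CopWin (burn E r r') c' r' → CopWinIn B (burn E r r') c' r')
  where

  W : ℕ → Fin n → Set
  W j c = CopWinIn (j + B) E c r

  -- Once the cop is at c', every robber reply is answered within j + B
  -- rounds: traversals by hypothesis, staying put because c' ∈ W j.
  replies : ∀ j c' → (∀ r' → E r r' ≡ true → CopWin (burn E r r') c' r') →
            (burn E r r ≐ E → W j c') →
            ∀ r' → Move E r r' → CopWinIn (j + B) (burn E r r') c' r'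
  replies j c' traverse stay r' mv with robberMove mv
  ... | inj₁ Err' =
    copWinIn-mono (m≤n+m B j) (afterTraversal r' Err' c' (traverse r' Err'))
  ... | inj₂ (refl , same) = copWinIn-resp (≐-sym same) (stay same)

  increasing : ∀ j {c} → W j c → W (suc j) c
  increasing j = copWinIn-mono (n≤1+n (j + B))

  propagates : ∀ j → (∀ {c} → W (suc j) c → W j c) →
               ∀ {c} → W (suc (suc j)) c → W (suc j) c
  propagates j stagnant (inj₁ c≡r) = inj₁ c≡r
  propagates j stagnant (inj₂ (c' , mv , inj₁ c'≡r)) = inj₂ (c' , mv , inj₁ c'≡r)
  propagates j stagnant (inj₂ (c' , mv , inj₂ win)) =
    inj₂ (c' , mv , inj₂ (replies j c' traverse stay))
    where
    traverse : ∀ r' → E r r' ≡ true → CopWin (burn E r r') c' r'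
    traverse r' Err' = copWinIn⇒copWin (win r' (inj₂ Err'))

    stay : burn E r r ≐ E → W j c'
    stay same = stagnant (copWinIn-resp same (win r (inj₁ refl)))

  stagnated : ∀ {c} → W (suc n) c → W n c
  stagnated =
    predicate-chain-stagnates W (λ j c → copWinIn? (j + B) E c r) increasing propagates

  -- By induction on the winning strategy: its first move puts c into W (n + 1).
  phase : ∀ {E' c} → E' ≐ E → CopWin E' c r → W n c
  phase E'≐E (caught c≡r) = stagnated (inj₁ c≡r)
  phase E'≐E (step c' mv (inj₁ c'≡r)) =
    stagnated (inj₂ (c' , move-resp E'≐E mv , inj₁ c'≡r))
  phase E'≐E (step c' mv (inj₂ win)) =
    stagnated (inj₂ (c' , move-resp E'≐E mv , inj₂ (replies n c' traverse stay)))
    where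
    traverse : ∀ r' → E r r' ≡ true → CopWin (burn E r r') c' r'
    traverse r' Err' =
      copWin-resp (burn-resp E'≐E) (win r' (move-resp (≐-sym E'≐E) (inj₂ Err')))

    stay : burn E r r ≐ E → W n c'
    stay same = phase (≐-trans (burn-resp E'≐E) same) (win r (inj₁ refl))

-- Induction on a bound m for the edge count: one phase per burnt edge, so a
-- won position is won within (m + 1)·n rounds.
captureWithin : ∀ {n} m (E : Edges n) → edgeCount E ≤ m →
                ∀ {c r} → CopWin E c r → CopWinIn (suc m * n) E c r
captureWithin zero E noEdges {r = r} = Phase.phase E r 0 impossible ≐-refl
  where
  impossible : ∀ r' → E r r' ≡ true → ∀ c' →
               CopWin (burn E r r') c' r' → CopWinIn 0 (burn E r r') c' r'
  impossible r' Err' = contradiction (<-≤-trans (edgeCount-burn E r r' Err') noEdges) n≮0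
captureWithin {n} (suc m) E fewEdges {r = r} =
  Phase.phase E r (suc m * n) afterTraversal ≐-refl
  where
  afterTraversal : ∀ r' → E r r' ≡ true → ∀ c' →
                   CopWin (burn E r r') c' r' → CopWinIn (suc m * n) (burn E r r') c' r'
  afterTraversal r' Err' c' =
    captureWithin m (burn E r r') (≤-pred (<-≤-trans (edgeCount-burn E r r' Err') fewEdges))

-- (n² + 1)·n ≤ 2n³: at most n² + 1 phases of at most n rounds each.
cubicBound : ∀ n → suc (n * n) * n ≤ 2 * n ^ 3
cubicBound n = begin
  suc (n * n) * n   ≡⟨⟩
  n + n * n * n     ≤⟨ +-monoˡ-≤ (n * n * n) (n≤n³ n) ⟩
  n ^ 3 + n * n * n ≡⟨ doubled n ⟩
  2 * n ^ 3         ∎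
  where
  open ≤-Reasoning

  n≤n³ : ∀ k → k ≤ k ^ 3
  n≤n³ zero        = z≤n
  n≤n³ k@(suc _) = m≤m*n k (k ^ 2)

  -- k ^ 3 unfolds to k * (k * (k * 1)).
  doubled : ∀ k → k * (k * (k * 1)) + k * k * k ≡ 2 * (k * (k * (k * 1)))
  doubled = solve-∀

theorem5p1 : Σ ℕ λ C → (n : ℕ) (G : Graph n) → OneCopWins G →
               CaptureWithin G (C * n ^ 3)
theorem5p1 = 2 , λ n G (c₀ , wins) → c₀ , λ r₀ →
  copWinIn-mono (cubicBound n) (captureWithin (n * n) (adj G) (edgeCount≤ (adj G)) (wins r₀))
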